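{- Let $w=(f,\pi)\in\mathcal{W}$ and suppose that distinct $i,j\in\Omega$ satisfy $w(C_i)=C_j$, $w(C_j)=C_i$, and $w^2(\alpha)=\alpha$ for every $\alpha\in C_i\cup C_j$. Then there exists an integer $0\le s<n$ such that $w(\alpha)=\rho_i^{ -s}\pi\rho_i^s(\alpha)$ for every $\alpha\in C_i\cup C_j$, where $\pi$ is identified with the element $(e,\pi)\in\mathcal{W}$ ($e$ the zero function).
   Context: Fix positive integers $n,r$. Let $A=\mathbb{Z}/n\mathbb{Z}$, $\Omega=\{1,\ldots,r\}$, $S_r$ the symmetric group on $\Omega$, and $A^r$ the group of functions $\Omega\to A$ under pointwise addition. For $\pi\in S_r$ and $g\in A^r$ let $g_\pi(i)=g(\pi^{ -1}(i))$. The wreath product $\mathcal{W}=A\wr S_r$ is the set of pairs $(f,\pi)$ with multiplication $(f,\pi)(g,\sigma)=(f+g_\pi,\pi\sigma)$, acting on $X=A\times\Omega$ by $(f,\pi)(a,i)=(f(\pi(i))+a,\pi(i))$. For $i\in\Omega$, $C_i=A\times\{i\}$, $\delta_i\in A^r$ has $\delta_i(i)=1$ and $\delta_i(j)=0$ for $j\ne i$, and $\rho_i=(\delta_i,1)$. For $w\in\mathcal{W}$, $w(C_i)=\{w(\alpha):\alpha\in C_i\}$. -}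

module Defs where

open import Data.Nat using (ℕ; zero; suc; NonZero; _∸_) renaming (_+_ to _+ℕ_)
open import Data.Nat.DivMod using (_mod_)
open import Data.Fin using (Fin; toℕ)
open import Data.Fin.Permutation using (Permutation′; _⟨$⟩ʳ_; _⟨$⟩ˡ_; _∘ₚ_; flip; id)
open import Data.Product using (_×_; _,_; proj₁; proj₂; ∃)
open import Data.Sum using (_⊎_)
open import Relation.Binary.PropositionalEquality using (_≡_)
open import Relation.Nullary using (¬_)

module _ (n : ℕ) .{{_ : NonZero n}} where

  A : Set
  A = Fin n

  _⊕_ : A → A → A
  a ⊕ b = (toℕ a +ℕ toℕ b) mod n

  ⊖_ : A → A
  ⊖ a = (n ∸ toℕ a) mod n

  zeroA : A
  zeroA = 0 mod n

  oneA : A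
  oneA = 1 mod n

module _ {n : ℕ} .{{_ : NonZero n}} {r : ℕ} where

  Fun : Set
  Fun = Fin r → A n

  W : Set
  W = Fun × Permutation′ r

  _·ᶠ_ : Permutation′ r → Fun → Fun
  (π ·ᶠ g) i = g (π ⟨$⟩ˡ i)

  -- (f,π)(g,σ) = (f + g_π , πσ), with (πσ)(i) = π(σ(i))
  _∙_ : W → W → W
  (f , π) ∙ (g , σ) = (λ i → _⊕_ n (f i) ((π ·ᶠ g) i)) , (σ ∘ₚ π)

  eW : W
  eW = (λ _ → zeroA n) , id

  invW : W → W
  invW (f , π) = (λ i → ⊖_ n ((flip π ·ᶠ f) i)) , flip π

  powW : W → ℕ → W
  powW w zero = eW
  powW w (suc s) = w ∙ powW w s

  X : Set
  X = A n × Fin r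

  act : W → X → X
  act (f , π) (a , i) = _⊕_ n (f (π ⟨$⟩ʳ i)) a , π ⟨$⟩ʳ i

  δ : Fin r → Fun
  δ i j with i Data.Fin.≟ j
  ... | Relation.Nullary.yes _ = oneA n
  ... | Relation.Nullary.no _ = zeroA n

  ρ : Fin r → W
  ρ i = δ i , id

  perm : Permutation′ r → W
  perm π = (λ _ → zeroA n) , π

  _∈C_ : X → Fin r → Set
  α ∈C i = proj₂ α ≡ i

  _maps_onto_ : W → Fin r → Fin r → Set
  w maps i onto j = (∀ α → α ∈C i → act w α ∈C j)
                  × (∀ β → β ∈C j → ∃ λ α → α ∈C i × act w α ≡ β)

{-# OPTIONS --safe #-}
module Submission where

-- Conjugating the pure permutation (e , π) by the translation ρᵢˢ = (s δᵢ , 1)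
-- gives the element acting by (a , x) ↦ (a + s δᵢ(x) − s δᵢ(π x) , π x).  As π
-- swaps i and j, on Cᵢ ∪ Cⱼ it translates by s on Cᵢ and by −s on Cⱼ, whereas w
-- translates by f(j) on Cᵢ and by f(i) on Cⱼ.  Evaluating w² = 1 at (0 , i) gives
-- f(i) + f(j) = 0, so s = f(j) works.

open import Defs
open import Data.Nat using (ℕ; NonZero; >-nonZero⁻¹; zero; suc; _+_; _∸_; _%_)
open import Data.Nat.Properties using (+-comm; +-assoc; +-identityʳ; m∸n+n≡m; <⇒≤)
open import Data.Nat.DivMod
  using (_mod_; m%n<n; m<n⇒m%n≡m; n%n≡0; [m+n]%n≡m%n; m%n%n≡m%n; %-distribˡ-+; %-congˡ)
open import Data.Fin using (Fin; toℕ; _≟_)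
open import Data.Fin.Properties using (toℕ-injective; toℕ-fromℕ<; toℕ<n)
open import Data.Fin.Permutation using (Permutation′; _⟨$⟩ʳ_; _⟨$⟩ˡ_; inverseˡ)
open import Data.Product using (_,_; ∃; proj₁; proj₂)
open import Data.Sum using (_⊎_; inj₁; inj₂)
open import Relation.Nullary using (yes; no; contradiction)
open import Relation.Binary.PropositionalEquality

private
  module Notation (n : ℕ) .{{_ : NonZero n}} where
    infixl 6 _+ₙ_
    infix 8 -ₙ_
    _+ₙ_ : A n → A n → A n
    _+ₙ_ = _⊕_ n
    -ₙ_ : A n → A n
    -ₙ_ = ⊖_ n

module _ (n : ℕ) .{{_ : NonZero n}} where
  open Notation n

  toℕ-mod : ∀ m → toℕ (m mod n) ≡ m % n
  toℕ-mod m = toℕ-fromℕ< (m%n<n m n)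

  toℕ-%-id : (a : A n) → toℕ a % n ≡ toℕ a
  toℕ-%-id a = m<n⇒m%n≡m (toℕ<n a)

  mod-cong-% : ∀ {a b} → a % n ≡ b % n → a mod n ≡ b mod n
  mod-cong-% {a} {b} eq = toℕ-injective (trans (toℕ-mod a) (trans eq (sym (toℕ-mod b))))

  toℕ-mod-id : (a : A n) → toℕ a mod n ≡ a
  toℕ-mod-id a = toℕ-injective (trans (toℕ-mod (toℕ a)) (toℕ-%-id a))

  toℕ-zeroA : toℕ (zeroA n) ≡ 0
  toℕ-zeroA = trans (toℕ-mod 0) (m<n⇒m%n≡m (>-nonZero⁻¹ n))

  ⊕-identityʳ : (a : A n) → a +ₙ zeroA n ≡ a
  ⊕-identityʳ a = toℕ-injective (begin
    toℕ (a +ₙ zeroA n)          ≡⟨ toℕ-mod _ ⟩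
    (toℕ a + toℕ (zeroA n)) % n ≡⟨ cong (λ z → (toℕ a + z) % n) toℕ-zeroA ⟩
    (toℕ a + 0) % n             ≡⟨ %-congˡ (+-identityʳ (toℕ a)) ⟩
    toℕ a % n                   ≡⟨ toℕ-%-id a ⟩
    toℕ a                       ∎)
    where open ≡-Reasoning

  ⊕-identityˡ : (a : A n) → zeroA n +ₙ a ≡ a
  ⊕-identityˡ a =
    toℕ-injective (trans (toℕ-mod _) (trans (cong (λ z → (z + toℕ a) % n) toℕ-zeroA) (toℕ-%-id a)))

  ⊖-zero : -ₙ zeroA n ≡ zeroA n
  ⊖-zero = toℕ-injective (begin
    toℕ (-ₙ zeroA n)        ≡⟨ toℕ-mod _ ⟩
    (n ∸ toℕ (zeroA n)) % n ≡⟨ cong (λ z → (n ∸ z) % n) toℕ-zeroA ⟩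
    n % n                   ≡⟨ n%n≡0 n ⟩
    0                       ≡⟨ toℕ-zeroA ⟨
    toℕ (zeroA n)           ∎)
    where open ≡-Reasoning

  ⊕≡zero⇒≡⊖ : (a b : A n) → a +ₙ b ≡ zeroA n → a ≡ -ₙ b
  ⊕≡zero⇒≡⊖ a b a+b≡0 = toℕ-injective (begin
    x                             ≡⟨ toℕ-%-id a ⟨
    x % n                         ≡⟨ [m+n]%n≡m%n x n ⟨
    (x + n) % n                   ≡⟨ %-congˡ (cong (x +_) (m∸n+n≡m (<⇒≤ (toℕ<n b)))) ⟨
    (x + (-y + y)) % n            ≡⟨ %-congˡ (cong (x +_) (+-comm -y y)) ⟩
    (x + (y + -y)) % n            ≡⟨ %-congˡ (+-assoc x y -y) ⟨
    ((x + y) + -y) % n            ≡⟨ %-distribˡ-+ (x + y) -y n ⟩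
    ((x + y) % n + -y % n) % n    ≡⟨ cong (λ z → (z + -y % n) % n) sum≡0 ⟩
    -y % n % n                    ≡⟨ m%n%n≡m%n -y n ⟩
    -y % n                        ≡⟨ toℕ-mod -y ⟨
    toℕ (-ₙ b)                    ∎)
    where
    open ≡-Reasoning
    x y -y : ℕ
    x = toℕ a
    y = toℕ b
    -y = n ∸ y
    sum≡0 : (x + y) % n ≡ 0
    sum≡0 = trans (sym (toℕ-mod (x + y))) (trans (cong toℕ a+b≡0) toℕ-zeroA)

  oneA-⊕-mod : ∀ t → oneA n +ₙ t mod n ≡ suc t mod n
  oneA-⊕-mod t = mod-cong-%
    (trans (cong₂ (λ u v → (u + v) % n) (toℕ-mod 1) (toℕ-mod t)) (sym (%-distribˡ-+ 1 t n)))

module _ {n : ℕ} .{{_ : NonZero n}} {r : ℕ} (i : Fin r) where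
  open Notation n

  powW-ρ-fixesʳ : ∀ t k → proj₂ (powW (ρ i) t) ⟨$⟩ʳ k ≡ k
  powW-ρ-fixesʳ zero    k = refl
  powW-ρ-fixesʳ (suc t) k = powW-ρ-fixesʳ t k

  powW-ρ-fixesˡ : ∀ t k → proj₂ (powW (ρ i) t) ⟨$⟩ˡ k ≡ k
  powW-ρ-fixesˡ zero    k = refl
  powW-ρ-fixesˡ (suc t) k = powW-ρ-fixesˡ t k

  powW-ρ-at : ∀ t → proj₁ (powW (ρ i) t) i ≡ t mod n
  powW-ρ-at zero = refl
  powW-ρ-at (suc t) with i ≟ i
  ... | yes _  = trans (cong (oneA n +ₙ_) (powW-ρ-at t)) (oneA-⊕-mod n t)
  ... | no i≢i = contradiction refl i≢i

  powW-ρ-off : ∀ t {k} → i ≢ k → proj₁ (powW (ρ i) t) k ≡ zeroA n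
  powW-ρ-off zero    i≢k = refl
  powW-ρ-off (suc t) {k} i≢k with i ≟ k
  ... | yes i≡k = contradiction i≡k i≢k
  ... | no _    = trans (cong (zeroA n +ₙ_) (powW-ρ-off t i≢k)) (⊕-identityʳ n (zeroA n))

module _ {n : ℕ} .{{_ : NonZero n}} {r : ℕ} where
  open Notation n

  act-conj-perm : (P : W {n} {r}) (π : Permutation′ r) (a : A n) (x : Fin r) →
    let g = proj₁ P ; σ = proj₂ P ; y = σ ⟨$⟩ˡ (π ⟨$⟩ʳ (σ ⟨$⟩ʳ x)) in
    act ((invW P ∙ perm π) ∙ P) (a , x)
      ≡ ((-ₙ g (σ ⟨$⟩ʳ y) +ₙ zeroA n) +ₙ g (π ⟨$⟩ˡ (σ ⟨$⟩ʳ y)) +ₙ a , y)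
  act-conj-perm P π a x = refl

  -- The permutation part of ρᵢᵗ is id ∘ₚ ⋯ ∘ₚ id, which is only pointwise equal
  -- to id; hence the hypotheses instead of asking for P = (g , id).
  act-conj-perm-translation : (P : W {n} {r}) →
    (∀ k → proj₂ P ⟨$⟩ʳ k ≡ k) → (∀ k → proj₂ P ⟨$⟩ˡ k ≡ k) →
    (π : Permutation′ r) (a : A n) (x : Fin r) →
    act ((invW P ∙ perm π) ∙ P) (a , x)
      ≡ (-ₙ proj₁ P (π ⟨$⟩ʳ x) +ₙ proj₁ P x +ₙ a , π ⟨$⟩ʳ x)
  act-conj-perm-translation P fixʳ fixˡ π a x
    rewrite act-conj-perm P π a x | fixʳ x | fixˡ (π ⟨$⟩ʳ x) | fixʳ (π ⟨$⟩ʳ x) | inverseˡ π {x}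
          | ⊕-identityʳ n (-ₙ proj₁ P (π ⟨$⟩ʳ x)) = refl

module SwapConjugation {n : ℕ} .{{_ : NonZero n}} {r : ℕ} (π : Permutation′ r) {i j : Fin r}
         (i≢j : i ≢ j) (πi≡j : π ⟨$⟩ʳ i ≡ j) (πj≡i : π ⟨$⟩ʳ j ≡ i) where
  open Notation n
  open ≡-Reasoning

  conjByPowρ : ℕ → W {n} {r}
  conjByPowρ t = (invW (powW (ρ i) t) ∙ perm π) ∙ powW (ρ i) t

  act-conjByPowρ : ∀ t a x →
    act (conjByPowρ t) (a , x)
      ≡ (-ₙ proj₁ (powW (ρ i) t) (π ⟨$⟩ʳ x) +ₙ proj₁ (powW (ρ i) t) x +ₙ a , π ⟨$⟩ʳ x)
  act-conjByPowρ t =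
    act-conj-perm-translation (powW (ρ i) t) (powW-ρ-fixesʳ i t) (powW-ρ-fixesˡ i t) π

  act-conjByPowρ-i : ∀ t a → act (conjByPowρ t) (a , i) ≡ (t mod n +ₙ a , j)
  act-conjByPowρ-i t a = begin
    act (conjByPowρ t) (a , i)       ≡⟨ act-conjByPowρ t a i ⟩
    (-ₙ g (π ⟨$⟩ʳ i) +ₙ g i +ₙ a , π ⟨$⟩ʳ i) ≡⟨ cong (λ k → -ₙ g k +ₙ g i +ₙ a , k) πi≡j ⟩
    (-ₙ g j +ₙ g i +ₙ a , j)          ≡⟨ cong (λ u → -ₙ u +ₙ g i +ₙ a , j) (powW-ρ-off i t i≢j) ⟩
    (-ₙ zeroA n +ₙ g i +ₙ a , j)      ≡⟨ cong (λ u → u +ₙ g i +ₙ a , j) (⊖-zero n) ⟩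
    (zeroA n +ₙ g i +ₙ a , j)         ≡⟨ cong (λ u → u +ₙ a , j) (⊕-identityˡ n (g i)) ⟩
    (g i +ₙ a , j)                    ≡⟨ cong (λ u → u +ₙ a , j) (powW-ρ-at i t) ⟩
    (t mod n +ₙ a , j)                ∎
    where g = proj₁ (powW (ρ i) t)

  act-conjByPowρ-j : ∀ t a → act (conjByPowρ t) (a , j) ≡ (-ₙ (t mod n) +ₙ a , i)
  act-conjByPowρ-j t a = begin
    act (conjByPowρ t) (a , j)       ≡⟨ act-conjByPowρ t a j ⟩
    (-ₙ g (π ⟨$⟩ʳ j) +ₙ g j +ₙ a , π ⟨$⟩ʳ j) ≡⟨ cong (λ k → -ₙ g k +ₙ g j +ₙ a , k) πj≡i ⟩
    (-ₙ g i +ₙ g j +ₙ a , i)          ≡⟨ cong (λ u → -ₙ g i +ₙ u +ₙ a , i) (powW-ρ-off i t i≢j) ⟩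
    (-ₙ g i +ₙ zeroA n +ₙ a , i)      ≡⟨ cong (λ u → u +ₙ a , i) (⊕-identityʳ n (-ₙ g i)) ⟩
    (-ₙ g i +ₙ a , i)                 ≡⟨ cong (λ u → -ₙ u +ₙ a , i) (powW-ρ-at i t) ⟩
    (-ₙ (t mod n) +ₙ a , i)           ∎
    where g = proj₁ (powW (ρ i) t)

  involutive⇒⊕≡zero : (f : Fin r → A n) →
    act (f , π) (act (f , π) (zeroA n , i)) ≡ (zeroA n , i) → f i +ₙ f j ≡ zeroA n
  involutive⇒⊕≡zero f ww≡id = begin
    f i +ₙ f j                                          ≡⟨ cong₂ (λ k u → f k +ₙ u)
                                                             (sym (trans (cong (π ⟨$⟩ʳ_) πi≡j) πj≡i))
                                                             (sym (trans (⊕-identityʳ n _) (cong f πi≡j))) ⟩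
    f (π ⟨$⟩ʳ (π ⟨$⟩ʳ i)) +ₙ (f (π ⟨$⟩ʳ i) +ₙ zeroA n)  ≡⟨ cong proj₁ ww≡id ⟩
    zeroA n                                             ∎

lemma5p4 : (n : ℕ) .{{_ : NonZero n}} (r : ℕ)
    (f : Fin r → Fin n) (π : Permutation′ r) (i j : Fin r) →
    i ≢ j →
    (f , π) maps i onto j →
    (f , π) maps j onto i →
    (∀ (α : X {n} {r}) → (α ∈C i ⊎ α ∈C j) → act (f , π) (act (f , π) α) ≡ α) →
    ∃ λ (s : Fin n) → ∀ (α : X {n} {r}) → (α ∈C i ⊎ α ∈C j) →
    act (f , π) α ≡ act ((invW (powW (ρ i) (toℕ s)) ∙ perm π) ∙ powW (ρ i) (toℕ s)) α
lemma5p4 n r f π i j i≢j (into-j , _) (into-i , _) involutive = f j , agrees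
  where
  open ≡-Reasoning
  open Notation n
  πi≡j : π ⟨$⟩ʳ i ≡ j
  πi≡j = into-j (zeroA n , i) refl
  πj≡i : π ⟨$⟩ʳ j ≡ i
  πj≡i = into-i (zeroA n , j) refl

  open SwapConjugation π i≢j πi≡j πj≡i

  fi≡⊖fj : f i ≡ -ₙ f j
  fi≡⊖fj = ⊕≡zero⇒≡⊖ n (f i) (f j)
    (involutive⇒⊕≡zero f (involutive (zeroA n , i) (inj₁ refl)))

  s : ℕ
  s = toℕ (f j)

  agrees : ∀ (α : X {n} {r}) → (α ∈C i ⊎ α ∈C j) → act (f , π) α ≡ act (conjByPowρ s) α
  agrees (a , .i) (inj₁ refl) = begin
    (f (π ⟨$⟩ʳ i) +ₙ a , π ⟨$⟩ʳ i)      ≡⟨ cong (λ k → f k +ₙ a , k) πi≡j ⟩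
    (f j +ₙ a , j)                      ≡⟨ cong (λ u → u +ₙ a , j) (toℕ-mod-id n (f j)) ⟨
    (s mod n +ₙ a , j)                  ≡⟨ act-conjByPowρ-i s a ⟨
    act (conjByPowρ s) (a , i) ∎
  agrees (a , .j) (inj₂ refl) = begin
    (f (π ⟨$⟩ʳ j) +ₙ a , π ⟨$⟩ʳ j)      ≡⟨ cong (λ k → f k +ₙ a , k) πj≡i ⟩
    (f i +ₙ a , i)                      ≡⟨ cong (λ u → u +ₙ a , i) (trans fi≡⊖fj (cong -ₙ_ (sym (toℕ-mod-id n (f j))))) ⟩
    (-ₙ (s mod n) +ₙ a , i)             ≡⟨ act-conjByPowρ-j s a ⟨
    act (conjByPowρ s) (a , j) ∎
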